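{- Let $F$ be a homogeneous symmetric function of degree $n$ with rational coefficients such that $\omega(F)$ is $p$-positive. Then there exist real numbers $b_\alpha\ge 0$, indexed by compositions $\alpha\models n$, such that $F=\sum_{\alpha\models n}b_\alpha\,(C_\alpha 1)\big|_{q=1}=\sum_{\alpha\models n}(-1)^{n-\ell(\alpha)}b_\alpha h_\alpha.$
   Context: $\omega$ is the involution of symmetric functions with $\omega(p_k)=(-1)^{k-1}p_k$; $p$-positive means nonnegative coefficients in the power sum basis. For a composition $\alpha=(\alpha_1,\dots,\alpha_\ell)$, $\ell(\alpha)=\ell$ and $h_\alpha=h_{\alpha_1}\cdots h_{\alpha_\ell}$. Using plethystic notation, for a positive integer $a$ the operator $C_a$ on symmetric functions with coefficients in $\mathbb Q(q)$ is $C_aF[X]=\Big(\big(-\tfrac1q\big)^{a-1}F\big[X-\tfrac{1-1/q}{z}\big]\sum_{m\ge0}z^mh_m[X]\Big)\Big|_{z^a},$ where $|_{z^a}$ takes the coefficient of $z^a$; and $C_\alpha=C_{\alpha_1}\circ C_{\alpha_2}\circ\cdots\circ C_{\alpha_\ell}$. $(C_\alpha1)|_{q=1}$ denotes $C_\alpha$ applied to the constant $1$ and then specialized at $q=1$. -}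

module Defs where

open import Data.Nat as ℕ using (ℕ; zero; suc; _∸_; _⊔_)
open import Data.Nat.Properties using (≤-decTotalOrder)
open import Data.Integer as ℤ using (ℤ; +_)
open import Data.Rational as ℚ using (ℚ; 0ℚ; 1ℚ)
open import Data.List using (List; []; _∷_; [_]; _++_; map; concat; concatMap; zipWith; upTo; filter; foldr; length)
open import Data.Nat.ListAction using (sum)
open import Data.List.Relation.Unary.All using (All)
open import Data.List.Properties using (≡-dec)
open import Data.List.Sort.InsertionSort.Base ≤-decTotalOrder using (sort)
open import Data.List.Relation.Unary.Sorted.TotalOrder (Data.Nat.Properties.≤-totalOrder) using (Sorted)
open import Relation.Binary.PropositionalEquality using (_≡_)

-- Symmetric functions are represented in power-sum coordinates:
-- Λ = ℚ(q)[p₁,p₂,…]; we only need coefficients in Laurent polynomials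
-- ℚ[q,q⁻¹], plus an auxiliary Laurent variable z for the operators C_a.
-- A term  c · q^qe · z^ze · p_{k₁} ⋯ p_{k_r}  with parts = k₁ ∷ … ∷ k_r.

record Term : Set where
  constructor term
  field
    coef  : ℚ
    qe    : ℤ
    ze    : ℤ
    parts : List ℕ

open Term public

Poly : Set
Poly = List Term

mono : ℚ → ℤ → ℤ → Poly
mono c i j = [ term c i j [] ]

one : Poly
one = mono 1ℚ (+ 0) (+ 0)

pw : ℕ → Poly
pw k = [ term 1ℚ (+ 0) (+ 0) [ k ] ]

mulT : Term → Term → Term
mulT (term c i j λs) (term d k l μs) = term (c ℚ.* d) (i ℤ.+ k) (j ℤ.+ l) (λs ++ μs)

infixl 7 _⊗_
_⊗_ : Poly → Poly → Poly
P ⊗ Q = concatMap (λ s → map (mulT s) Q) P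

scale : ℚ → Poly → Poly
scale c P = mono c (+ 0) (+ 0) ⊗ P

sgn : ℕ → ℚ
sgn zero = 1ℚ
sgn (suc k) = ℚ.- sgn k

-- Plethystic substitution X ↦ X - (1 - 1/q)/z :
--   p_k[X - (1-1/q)/z] = p_k - (1 - q^{-k}) z^{-k}
--                      = p_k - z^{-k} + q^{-k} z^{-k}
-- (q is a scalar of the coefficient field; only X is substituted).

plethP : ℕ → Poly
plethP k = pw k ++ (mono (ℚ.- 1ℚ) (+ 0) (ℤ.- (+ k)) ++ mono 1ℚ (ℤ.- (+ k)) (ℤ.- (+ k)))

plethParts : List ℕ → Poly
plethParts [] = one
plethParts (k ∷ ks) = plethP k ⊗ plethParts ks

plethT : Term → Poly
plethT (term c i j λs) = mono c i j ⊗ plethParts λs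

pleth : Poly → Poly
pleth = concatMap plethT

-- Complete homogeneous symmetric functions in the p-basis, via Newton:
--   h₀ = 1,  m h_m = Σ_{i=1}^m p_i h_{m-i}.
-- hs m = h_m ∷ h_{m-1} ∷ … ∷ h₀

hs : ℕ → List Poly
hs zero = one ∷ []
hs (suc m) =
  scale (+ 1 ℚ./ suc m) (concat (zipWith (λ i h → pw i ⊗ h) (map suc (upTo (suc m))) (hs m)))
  ∷ hs m

h : ℕ → Poly
h m with hs m
... | x ∷ _ = x
... | [] = []

hProd : List ℕ → Poly
hProd [] = one
hProd (a ∷ α) = h a ⊗ hProd α

-- Σ_{m=0}^{M} z^m h_m[X]  (truncation of Σ_{m≥0} z^m h_m; exact for
-- extracting z^a below since pleth F has z-degrees in [-deg F, 0]).
genH : ℕ → Poly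
genH M = concat (map (λ m → mono 1ℚ (+ 0) (+ m) ⊗ h m) (upTo (suc M)))

degBound : Poly → ℕ
degBound = foldr (λ t r → sum (parts t) ⊔ r) 0

coeffZ : ℕ → Poly → Poly
coeffZ a P = map (λ t → term (coef t) (qe t) (+ 0) (parts t))
                 (filter (λ t → ze t ℤ.≟ + a) P)

C : ℕ → Poly → Poly
C a F = mono (sgn (a ∸ 1)) (ℤ.- (+ (a ∸ 1))) (+ 0)
        ⊗ coeffZ a (pleth F ⊗ genH (a ℕ.+ degBound F))

Cs : List ℕ → Poly → Poly
Cs [] F = F
Cs (a ∷ α) F = C a (Cs α F)

-- Partitions are written as weakly increasing lists of positive integers
-- (canonical ordering of the parts of a multiset).

IsPartition : List ℕ → Set
IsPartition μ = Sorted μ × All (λ k → 1 ℕ.≤ k) μ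
  where open import Data.Product using (_×_)

-- coefficient of p_μ after specialising q = 1 (q^i ↦ 1)
coeffQ1 : Poly → List ℕ → ℚ
coeffQ1 P μ = foldr (λ t r → coef t ℚ.+ r) 0ℚ
                (filter (λ t → ≡-dec ℕ._≟_ (sort (parts t)) μ) P)

comps : ℕ → List (List ℕ)
comps zero = [] ∷ []
comps (suc n) = map (1 ∷_) (comps n) ++ concatMap inc (comps n)
  where
  inc : List ℕ → List (List ℕ)
  inc [] = []
  inc (a ∷ r) = (suc a ∷ r) ∷ []

Σ[_]_ : {A : Set} → List A → (A → ℚ) → ℚ
Σ[ xs ] f = foldr (λ x r → f x ℚ.+ r) 0ℚ xs

-- A symmetric function with rational coefficients is given by its
-- coefficient function μ ↦ [p_μ]F (μ a partition).
-- ω(p_μ) = Π (-1)^{μ_i - 1} p_μ = (-1)^{|μ| - ℓ(μ)} p_μ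
ω : (List ℕ → ℚ) → (List ℕ → ℚ)
ω F μ = sgn (sum μ ∸ length μ) ℚ.* F μ

module Submission where

-- At q = 1 the plethystic shift X ↦ X − (1 − 1/q)/z is trivial, so C_a G = (−1)^{a−1} G h_a and
-- C_α 1 = (−1)^{n−ℓ(α)} h_α there. Newton's identity (m + 1) h_{m+1} = Σ_{j ≤ m} p_{j+1} h_{m−j}
-- rewrites (−1)^m p_{m+1} as (m + 1)(−1)^m h_{m+1} plus products of (−1)^j p_{j+1}, j < m, with
-- (−1)^{m−j−1} h_{m−j}; by strong induction every (−1)^{k−1} p_k, hence every
-- ω(p_μ) = (−1)^{|μ|−ℓ(μ)} p_μ, is a nonnegative combination of the signed h_α. Since
-- F = Σ_μ (ωF)(μ) ω(p_μ) with (ωF)(μ) ≥ 0, collecting coefficients gives the b_α.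

open import Defs
open import Data.Nat as ℕ using (ℕ; zero; suc; _∸_; _<_; z≤n; s≤s)
import Data.Nat.Properties as ℕP
open import Data.Integer as ℤ using (ℤ)
import Data.Integer.Properties as ℤP
open import Data.Rational as ℚ using (ℚ; 0ℚ; 1ℚ; _+_; _*_; -_; _≤_)
import Data.Rational.Properties as ℚP
open import Data.Nat.ListAction using (sum)
open import Data.Nat.Induction using (<-rec)
import Data.Nat.ListAction.Properties as ℕLP
open import Data.Rational.Solver using (module +-*-Solver)
open +-*-Solver using (solve; _:+_; _:*_; _:=_; :-_; con)
open import Data.List using (List; []; _∷_; [_]; _++_; map; concat; concatMap; zipWith; upTo; applyUpTo; length)
import Data.List.Properties as LP
open import Data.List.Relation.Unary.All as All using (All; []; _∷_)
import Data.List.Relation.Unary.All.Properties as AllP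
open import Data.List.Relation.Binary.Permutation.Propositional using (_↭_; ↭-trans; ↭-sym; ↭-reflexive; ↭⇒↭ₛ; prep)
import Data.List.Relation.Binary.Permutation.Propositional.Properties as ↭P
open import Data.List.Relation.Binary.Pointwise using (Pointwise-≡⇒≡)
open import Data.List.Sort.InsertionSort.Base ℕP.≤-decTotalOrder using (sort)
open import Data.List.Sort.InsertionSort.Properties ℕP.≤-decTotalOrder using (sort-↭; sort-↗)
open import Data.List.Relation.Unary.Sorted.TotalOrder ℕP.≤-totalOrder using (Sorted)
open import Data.List.Relation.Unary.Sorted.TotalOrder.Properties using (↗↭↗⇒≋)
open import Data.Product using (_×_; _,_; proj₁; proj₂; ∃)
open import Data.Empty using (⊥-elim)
open import Relation.Nullary using (Dec; yes; no; ¬_)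
open import Relation.Binary.PropositionalEquality hiding ([_])
open ≡-Reasoning

Σ-++ : {A : Set} (xs ys : List A) (f : A → ℚ) → Σ[ xs ++ ys ] f ≡ Σ[ xs ] f + Σ[ ys ] f
Σ-++ [] ys f = sym (ℚP.+-identityˡ _)
Σ-++ (x ∷ xs) ys f = trans (cong (f x +_) (Σ-++ xs ys f)) (sym (ℚP.+-assoc (f x) _ _))

Σ-map : {A B : Set} (g : A → B) (xs : List A) (f : B → ℚ) → Σ[ map g xs ] f ≡ Σ[ xs ] (λ x → f (g x))
Σ-map g [] f = refl
Σ-map g (x ∷ xs) f = cong (f (g x) +_) (Σ-map g xs f)

Σ-concatMap : {A B : Set} (g : A → List B) (xs : List A) (f : B → ℚ) →
  Σ[ concatMap g xs ] f ≡ Σ[ xs ] (λ x → Σ[ g x ] f)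
Σ-concatMap g [] f = refl
Σ-concatMap g (x ∷ xs) f = trans (Σ-++ (g x) (concatMap g xs) f) (cong (Σ[ g x ] f +_) (Σ-concatMap g xs f))

Σ-cong : {A : Set} (xs : List A) {f g : A → ℚ} → (∀ x → f x ≡ g x) → Σ[ xs ] f ≡ Σ[ xs ] g
Σ-cong [] e = refl
Σ-cong (x ∷ xs) e = cong₂ _+_ (e x) (Σ-cong xs e)

Σ-concatMap-cong : {A B : Set} (k : A → List B) (xs : List A) (g : B → ℚ) (f : A → ℚ) →
  (∀ x → Σ[ k x ] g ≡ f x) → Σ[ concatMap k xs ] g ≡ Σ[ xs ] f
Σ-concatMap-cong k xs g f eq = trans (Σ-concatMap k xs g) (Σ-cong xs eq)

Σ-cong-All : {A : Set} {xs : List A} {f g : A → ℚ} → All (λ x → f x ≡ g x) xs → Σ[ xs ] f ≡ Σ[ xs ] g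
Σ-cong-All [] = refl
Σ-cong-All (e ∷ es) = cong₂ _+_ e (Σ-cong-All es)

Σ-zero : {A : Set} (xs : List A) → Σ[ xs ] (λ _ → 0ℚ) ≡ 0ℚ
Σ-zero [] = refl
Σ-zero (x ∷ xs) = trans (ℚP.+-identityˡ _) (Σ-zero xs)

Σ-distrib-+ : {A : Set} (xs : List A) (f g : A → ℚ) → Σ[ xs ] (λ x → f x + g x) ≡ Σ[ xs ] f + Σ[ xs ] g
Σ-distrib-+ [] f g = refl
Σ-distrib-+ (x ∷ xs) f g = trans (cong ((f x + g x) +_) (Σ-distrib-+ xs f g))
  (solve 4 (λ a b c d → (a :+ b) :+ (c :+ d) := (a :+ c) :+ (b :+ d)) refl (f x) (g x) (Σ[ xs ] f) (Σ[ xs ] g))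

*-distribˡ-Σ : {A : Set} (c : ℚ) (xs : List A) (f : A → ℚ) → c * Σ[ xs ] f ≡ Σ[ xs ] (λ x → c * f x)
*-distribˡ-Σ c [] f = ℚP.*-zeroʳ c
*-distribˡ-Σ c (x ∷ xs) f = trans (ℚP.*-distribˡ-+ c (f x) _) (cong (c * f x +_) (*-distribˡ-Σ c xs f))

*-distribʳ-Σ : {A : Set} (c : ℚ) (xs : List A) (f : A → ℚ) → Σ[ xs ] f * c ≡ Σ[ xs ] (λ x → f x * c)
*-distribʳ-Σ c xs f = trans (ℚP.*-comm (Σ[ xs ] f) c)
  (trans (*-distribˡ-Σ c xs f) (Σ-cong xs (λ x → ℚP.*-comm c (f x))))

Σ-comm : {A B : Set} (xs : List A) (ys : List B) (f : A → B → ℚ) →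
  Σ[ xs ] (λ x → Σ[ ys ] (f x)) ≡ Σ[ ys ] (λ y → Σ[ xs ] (λ x → f x y))
Σ-comm [] ys f = sym (Σ-zero ys)
Σ-comm (x ∷ xs) ys f = trans (cong (Σ[ ys ] (f x) +_) (Σ-comm xs ys f))
  (sym (Σ-distrib-+ ys (f x) (λ y → Σ[ xs ] (λ x′ → f x′ y))))

0≤* : {p q : ℚ} → 0ℚ ≤ p → 0ℚ ≤ q → 0ℚ ≤ p * q
0≤* {p} {q} 0≤p 0≤q = ℚP.nonNegative⁻¹ _
  {{ℚP.nonNeg*nonNeg⇒nonNeg p {{ℚ.nonNegative 0≤p}} q {{ℚ.nonNegative 0≤q}}}}

0≤1 : 0ℚ ≤ 1ℚ
0≤1 = ℚP.<⇒≤ (ℚP.positive⁻¹ 1ℚ)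

Σ-nonNeg : {A : Set} {xs : List A} {f : A → ℚ} → All (λ x → 0ℚ ≤ f x) xs → 0ℚ ≤ Σ[ xs ] f
Σ-nonNeg [] = ℚP.≤-refl
Σ-nonNeg (0≤fx ∷ 0≤fxs) = ℚP.+-mono-≤ 0≤fx (Σ-nonNeg 0≤fxs)

χ : {P : Set} → Dec P → ℚ
χ (yes _) = 1ℚ
χ (no _) = 0ℚ

χ-yes : {P : Set} → P → (d : Dec P) → χ d ≡ 1ℚ
χ-yes p (yes _) = refl
χ-yes p (no ¬p) = ⊥-elim (¬p p)

χ-no : {P : Set} → ¬ P → (d : Dec P) → χ d ≡ 0ℚ
χ-no ¬p (yes p) = ⊥-elim (¬p p)
χ-no ¬p (no _) = refl

χ-cong : {P Q : Set} → (P → Q) → (Q → P) → (d : Dec P) (e : Dec Q) → χ d ≡ χ e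
χ-cong f g (yes p) e = sym (χ-yes (f p) e)
χ-cong f g (no ¬p) e = sym (χ-no (λ q → ¬p (g q)) e)

0≤χ : {P : Set} (d : Dec P) → 0ℚ ≤ χ d
0≤χ (yes _) = 0≤1
0≤χ (no _) = ℚP.≤-refl

χ-*-no : {P : Set} → ¬ P → (d : Dec P) (x : ℚ) → χ d * x ≡ 0ℚ
χ-*-no ¬p d x = trans (cong (_* x) (χ-no ¬p d)) (ℚP.*-zeroˡ x)

Σ-upTo-suc : (N : ℕ) (g : ℕ → ℚ) → Σ[ upTo (suc N) ] g ≡ g 0 + Σ[ upTo N ] (λ m → g (suc m))
Σ-upTo-suc N g = cong (g 0 +_) (trans (cong (λ xs → Σ[ xs ] g) (sym (LP.map-upTo suc N))) (Σ-map suc (upTo N) g))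

Σ-upTo-∷ʳ : (N : ℕ) (g : ℕ → ℚ) → Σ[ upTo (suc N) ] g ≡ Σ[ upTo N ] g + g N
Σ-upTo-∷ʳ N g = begin
  Σ[ upTo (suc N) ] g          ≡⟨ cong (λ xs → Σ[ xs ] g) (LP.upTo-∷ʳ N) ⟨
  Σ[ upTo N ++ [ N ] ] g       ≡⟨ Σ-++ (upTo N) [ N ] g ⟩
  Σ[ upTo N ] g + (g N + 0ℚ)   ≡⟨ cong (Σ[ upTo N ] g +_) (ℚP.+-identityʳ (g N)) ⟩
  Σ[ upTo N ] g + g N          ∎

Σ-χ-upTo : (a N : ℕ) (Y : ℕ → ℚ) → a < N → Σ[ upTo N ] (λ m → χ (m ℕ.≟ a) * Y m) ≡ Y a
Σ-χ-upTo zero (suc N) Y _ = begin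
  Σ[ upTo (suc N) ] (λ m → χ (m ℕ.≟ 0) * Y m)
    ≡⟨ Σ-upTo-suc N (λ m → χ (m ℕ.≟ 0) * Y m) ⟩
  1ℚ * Y 0 + Σ[ upTo N ] (λ m → χ (suc m ℕ.≟ 0) * Y (suc m))
    ≡⟨ cong₂ _+_ (ℚP.*-identityˡ (Y 0)) (Σ-cong (upTo N) (λ m → ℚP.*-zeroˡ (Y (suc m)))) ⟩
  Y 0 + Σ[ upTo N ] (λ _ → 0ℚ)
    ≡⟨ trans (cong (Y 0 +_) (Σ-zero (upTo N))) (ℚP.+-identityʳ (Y 0)) ⟩
  Y 0
    ∎
Σ-χ-upTo (suc a) (suc N) Y (s≤s a<N) = begin
  Σ[ upTo (suc N) ] (λ m → χ (m ℕ.≟ suc a) * Y m)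
    ≡⟨ Σ-upTo-suc N (λ m → χ (m ℕ.≟ suc a) * Y m) ⟩
  0ℚ * Y 0 + Σ[ upTo N ] (λ m → χ (suc m ℕ.≟ suc a) * Y (suc m))
    ≡⟨ cong₂ _+_ (ℚP.*-zeroˡ (Y 0)) (Σ-cong (upTo N) (λ m → cong (_* Y (suc m))
         (χ-cong ℕP.suc-injective (cong suc) (suc m ℕ.≟ suc a) (m ℕ.≟ a)))) ⟩
  0ℚ + Σ[ upTo N ] (λ m → χ (m ℕ.≟ a) * Y (suc m))
    ≡⟨ trans (ℚP.+-identityˡ _) (Σ-χ-upTo a N (λ m → Y (suc m)) a<N) ⟩
  Y (suc a)
    ∎

δ : List ℕ → List ℕ → ℚ
δ β α = χ (LP.≡-dec ℕ._≟_ β α)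

sort-cong-↭ : {xs ys : List ℕ} → xs ↭ ys → sort xs ≡ sort ys
sort-cong-↭ {xs} {ys} xs↭ys = Pointwise-≡⇒≡ (↗↭↗⇒≋ ℕP.≤-totalOrder (sort-↗ xs) (sort-↗ ys)
  (↭⇒↭ₛ (↭-trans (sort-↭ xs) (↭-trans xs↭ys (↭-sym (sort-↭ ys))))))

sort-idem : (xs : List ℕ) → sort (sort xs) ≡ sort xs
sort-idem xs = sort-cong-↭ (sort-↭ xs)

sort-Sorted : (xs : List ℕ) → Sorted xs → sort xs ≡ xs
sort-Sorted xs xs↗ = Pointwise-≡⇒≡ (↗↭↗⇒≋ ℕP.≤-totalOrder (sort-↗ xs) xs↗ (↭⇒↭ₛ (sort-↭ xs)))

-- ⟦ P ⟧ G forgets q, so it only sees P at q = 1. Both coeffQ1 and the extraction of a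
-- z-coefficient are pairings of this kind, and ⟦_⟧ turns ⊗ into a nested pairing.
Key : Set
Key = ℤ × List ℕ

key : Term → Key
key t = ze t , sort (parts t)

_∙_ : Key → Key → Key
(i , μ) ∙ (j , ν) = i ℤ.+ j , sort (μ ++ ν)

⟦_⟧ : Poly → (Key → ℚ) → ℚ
⟦ P ⟧ G = Σ[ P ] (λ t → coef t * G (key t))

key-mulT : (t s : Term) → key (mulT t s) ≡ key t ∙ key s
key-mulT (term c i j μ) (term d k l ν) =
  cong (j ℤ.+ l ,_) (sort-cong-↭ (↭P.++⁺ (↭-sym (sort-↭ μ)) (↭-sym (sort-↭ ν))))

∙-comm : (a b : Key) → a ∙ b ≡ b ∙ a
∙-comm (i , μ) (j , ν) = cong₂ _,_ (ℤP.+-comm i j) (sort-cong-↭ (↭P.++-comm μ ν))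

∙-assoc : (a b c : Key) → (a ∙ b) ∙ c ≡ a ∙ (b ∙ c)
∙-assoc (i , μ) (j , ν) (k , κ) = cong₂ _,_ (ℤP.+-assoc i j k)
  (sort-cong-↭ (↭-trans (↭P.++⁺ʳ κ (sort-↭ (μ ++ ν)))
    (↭-trans (↭-reflexive (LP.++-assoc μ ν κ)) (↭P.++⁺ˡ μ (↭-sym (sort-↭ (ν ++ κ)))))))

⟦⟧-++ : (P Q : Poly) (G : Key → ℚ) → ⟦ P ++ Q ⟧ G ≡ ⟦ P ⟧ G + ⟦ Q ⟧ G
⟦⟧-++ P Q G = Σ-++ P Q (λ t → coef t * G (key t))

⟦⟧-cong : (P : Poly) {G H : Key → ℚ} → (∀ k → G k ≡ H k) → ⟦ P ⟧ G ≡ ⟦ P ⟧ H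
⟦⟧-cong P G≗H = Σ-cong P (λ t → cong (coef t *_) (G≗H (key t)))

⟦⟧-* : (P : Poly) (c : ℚ) (G : Key → ℚ) → ⟦ P ⟧ (λ k → c * G k) ≡ c * ⟦ P ⟧ G
⟦⟧-* P c G = trans (Σ-cong P (λ t → solve 3 (λ a b x → a :* (b :* x) := b :* (a :* x)) refl (coef t) c (G (key t))))
  (sym (*-distribˡ-Σ c P _))

⟦⟧-Σ : {A : Set} (P : Poly) (xs : List A) (f : A → Key → ℚ) →
  ⟦ P ⟧ (λ k → Σ[ xs ] (λ x → f x k)) ≡ Σ[ xs ] (λ x → ⟦ P ⟧ (f x))
⟦⟧-Σ P xs f = trans (Σ-cong P (λ t → *-distribˡ-Σ (coef t) xs (λ x → f x (key t))))
  (Σ-comm P xs (λ t x → coef t * f x (key t)))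

⟦⟧-comm : (P Q : Poly) (H : Key → Key → ℚ) →
  ⟦ P ⟧ (λ a → ⟦ Q ⟧ (H a)) ≡ ⟦ Q ⟧ (λ b → ⟦ P ⟧ (λ a → H a b))
⟦⟧-comm P Q H = trans (⟦⟧-Σ P Q (λ s a → coef s * H a (key s)))
  (Σ-cong Q (λ s → ⟦⟧-* P (coef s) (λ a → H a (key s))))

⟦⟧-⊗ : (P Q : Poly) (G : Key → ℚ) → ⟦ P ⊗ Q ⟧ G ≡ ⟦ P ⟧ (λ a → ⟦ Q ⟧ (λ b → G (a ∙ b)))
⟦⟧-⊗ P Q G = trans (Σ-concatMap (λ t → map (mulT t) Q) P g)
  (Σ-cong P (λ t → trans (Σ-map (mulT t) Q g) (trans (Σ-cong Q (λ s →
    trans (cong (λ k → (coef t * coef s) * G k) (key-mulT t s)) (ℚP.*-assoc (coef t) (coef s) _)))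
    (sym (*-distribˡ-Σ (coef t) Q (λ s → coef s * G (key t ∙ key s)))))))
  where
  g : Term → ℚ
  g t = coef t * G (key t)

⟦⟧-⊗-comm : (P Q : Poly) (G : Key → ℚ) → ⟦ P ⊗ Q ⟧ G ≡ ⟦ Q ⊗ P ⟧ G
⟦⟧-⊗-comm P Q G = begin
  ⟦ P ⊗ Q ⟧ G                                   ≡⟨ ⟦⟧-⊗ P Q G ⟩
  ⟦ P ⟧ (λ a → ⟦ Q ⟧ (λ b → G (a ∙ b)))         ≡⟨ ⟦⟧-comm P Q (λ a b → G (a ∙ b)) ⟩
  ⟦ Q ⟧ (λ b → ⟦ P ⟧ (λ a → G (a ∙ b)))         ≡⟨ ⟦⟧-cong Q (λ b → ⟦⟧-cong P (λ a → cong G (∙-comm a b))) ⟩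
  ⟦ Q ⟧ (λ b → ⟦ P ⟧ (λ a → G (b ∙ a)))         ≡⟨ ⟦⟧-⊗ Q P G ⟨
  ⟦ Q ⊗ P ⟧ G                                   ∎

⟦⟧-⊗-assoc : (P Q R : Poly) (G : Key → ℚ) → ⟦ (P ⊗ Q) ⊗ R ⟧ G ≡ ⟦ P ⊗ (Q ⊗ R) ⟧ G
⟦⟧-⊗-assoc P Q R G = begin
  ⟦ (P ⊗ Q) ⊗ R ⟧ G                                              ≡⟨ ⟦⟧-⊗ (P ⊗ Q) R G ⟩
  ⟦ P ⊗ Q ⟧ (λ c → ⟦ R ⟧ (λ r → G (c ∙ r)))                      ≡⟨ ⟦⟧-⊗ P Q (λ c → ⟦ R ⟧ (λ r → G (c ∙ r))) ⟩
  ⟦ P ⟧ (λ a → ⟦ Q ⟧ (λ b → ⟦ R ⟧ (λ r → G ((a ∙ b) ∙ r))))      ≡⟨ ⟦⟧-cong P (λ a → ⟦⟧-cong Q (λ b → ⟦⟧-cong R (λ r → cong G (∙-assoc a b r)))) ⟩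
  ⟦ P ⟧ (λ a → ⟦ Q ⟧ (λ b → ⟦ R ⟧ (λ r → G (a ∙ (b ∙ r)))))      ≡⟨ ⟦⟧-cong P (λ a → ⟦⟧-⊗ Q R (λ d → G (a ∙ d))) ⟨
  ⟦ P ⟧ (λ a → ⟦ Q ⊗ R ⟧ (λ d → G (a ∙ d)))                      ≡⟨ ⟦⟧-⊗ P (Q ⊗ R) G ⟨
  ⟦ P ⊗ (Q ⊗ R) ⟧ G                                              ∎

⟦⟧-one : (G : Key → ℚ) → ⟦ one ⟧ G ≡ G (ℤ.+ 0 , [])
⟦⟧-one G = trans (ℚP.+-identityʳ _) (ℚP.*-identityˡ _)

⟦⟧-pw : (k : ℕ) (G : Key → ℚ) → ⟦ pw k ⟧ G ≡ G (ℤ.+ 0 , [ k ])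
⟦⟧-pw k G = trans (ℚP.+-identityʳ _) (ℚP.*-identityˡ _)

⟦⟧-sort : (P : Poly) (G : Key → ℚ) → ⟦ P ⟧ (λ k → G (proj₁ k , sort (proj₂ k))) ≡ ⟦ P ⟧ G
⟦⟧-sort P G = Σ-cong P (λ t → cong (λ μ → coef t * G (ze t , μ)) (sort-idem (parts t)))

⟦⟧-mono⊗ : (c : ℚ) (i j : ℤ) (P : Poly) (G : Key → ℚ) →
  ⟦ mono c i j ⊗ P ⟧ G ≡ c * ⟦ P ⟧ (λ b → G (j ℤ.+ proj₁ b , proj₂ b))
⟦⟧-mono⊗ c i j P G = trans (⟦⟧-⊗ (mono c i j) P G) (trans (ℚP.+-identityʳ _)
  (cong (c *_) (⟦⟧-sort P (λ b → G (j ℤ.+ proj₁ b , proj₂ b)))))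

⟦⟧-scale : (c : ℚ) (P : Poly) (G : Key → ℚ) → ⟦ scale c P ⟧ G ≡ c * ⟦ P ⟧ G
⟦⟧-scale c P G = trans (⟦⟧-mono⊗ c (ℤ.+ 0) (ℤ.+ 0) P G)
  (cong (c *_) (⟦⟧-cong P (λ b → cong (λ i → G (i , proj₂ b)) (ℤP.+-identityˡ (proj₁ b)))))

⟦⟧-one⊗ : (P : Poly) (G : Key → ℚ) → ⟦ one ⊗ P ⟧ G ≡ ⟦ P ⟧ G
⟦⟧-one⊗ P G = trans (⟦⟧-scale 1ℚ P G) (ℚP.*-identityˡ _)

⟦⟧-⊗one : (P : Poly) (G : Key → ℚ) → ⟦ P ⊗ one ⟧ G ≡ ⟦ P ⟧ G
⟦⟧-⊗one P G = trans (⟦⟧-⊗-comm P one G) (⟦⟧-one⊗ P G)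

⟦⟧-scale⊗ : (c : ℚ) (P Q : Poly) (G : Key → ℚ) → ⟦ scale c P ⊗ Q ⟧ G ≡ c * ⟦ P ⊗ Q ⟧ G
⟦⟧-scale⊗ c P Q G = trans (⟦⟧-⊗ (scale c P) Q G)
  (trans (⟦⟧-scale c P (λ a → ⟦ Q ⟧ (λ b → G (a ∙ b)))) (cong (c *_) (sym (⟦⟧-⊗ P Q G))))

⟦⟧-⊗scale : (c : ℚ) (P Q : Poly) (G : Key → ℚ) → ⟦ P ⊗ scale c Q ⟧ G ≡ c * ⟦ P ⊗ Q ⟧ G
⟦⟧-⊗scale c P Q G = trans (⟦⟧-⊗-comm P (scale c Q) G)
  (trans (⟦⟧-scale⊗ c Q P G) (cong (c *_) (⟦⟧-⊗-comm Q P G)))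

IsMonomial : List ℕ → Poly → Set
IsMonomial μ P = ∀ G → ⟦ P ⟧ G ≡ G (ℤ.+ 0 , sort μ)

IsMonomial-⊗ : (k : ℕ) (μ : List ℕ) (P Q : Poly) → IsMonomial [ k ] P → IsMonomial μ Q → IsMonomial (k ∷ μ) (P ⊗ Q)
IsMonomial-⊗ k μ P Q p q G = begin
  ⟦ P ⊗ Q ⟧ G                              ≡⟨ ⟦⟧-⊗ P Q G ⟩
  ⟦ P ⟧ (λ a → ⟦ Q ⟧ (λ b → G (a ∙ b)))    ≡⟨ p (λ a → ⟦ Q ⟧ (λ b → G (a ∙ b))) ⟩
  ⟦ Q ⟧ (λ b → G ((ℤ.+ 0 , [ k ]) ∙ b))    ≡⟨ q (λ b → G ((ℤ.+ 0 , [ k ]) ∙ b)) ⟩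
  G (ℤ.+ 0 , sort (k ∷ sort μ))            ≡⟨ cong (λ ν → G (ℤ.+ 0 , ν)) (sort-cong-↭ (prep k (sort-↭ μ))) ⟩
  G (ℤ.+ 0 , sort (k ∷ μ))                 ∎

-- At q = 1 the correction terms −z^{−k} and q^{−k} z^{−k} of p_k[X − (1 − 1/q)/z] cancel.
plethP-monomial : (k : ℕ) → IsMonomial [ k ] (plethP k)
plethP-monomial k G = solve 2 (λ A B → con 1ℚ :* A :+ (con (- 1ℚ) :* B :+ (con 1ℚ :* B :+ con 0ℚ)) := A)
  refl (G (ℤ.+ 0 , [ k ])) (G (ℤ.- (ℤ.+ k) , []))

plethParts-monomial : (μ : List ℕ) → IsMonomial μ (plethParts μ)
plethParts-monomial [] = ⟦⟧-one
plethParts-monomial (k ∷ μ) = IsMonomial-⊗ k μ (plethP k) (plethParts μ) (plethP-monomial k) (plethParts-monomial μ)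

⟦⟧-pleth : (F : Poly) (G : Key → ℚ) → ⟦ pleth F ⟧ G ≡ ⟦ F ⟧ G
⟦⟧-pleth F G = trans (Σ-concatMap plethT F (λ t → coef t * G (key t))) (Σ-cong F ⟦⟧-plethT)
  where
  ⟦⟧-plethT : (t : Term) → ⟦ plethT t ⟧ G ≡ coef t * G (key t)
  ⟦⟧-plethT (term c i j μ) = trans (⟦⟧-mono⊗ c i j (plethParts μ) G)
    (cong (c *_) (trans (plethParts-monomial μ (λ b → G (j ℤ.+ proj₁ b , proj₂ b)))
      (cong (λ i → G (i , sort μ)) (ℤP.+-identityʳ j))))

⟦⟧-pleth⊗ : (F Q : Poly) (G : Key → ℚ) → ⟦ pleth F ⊗ Q ⟧ G ≡ ⟦ F ⊗ Q ⟧ G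
⟦⟧-pleth⊗ F Q G = trans (⟦⟧-⊗ (pleth F) Q G) (trans (⟦⟧-pleth F (λ a → ⟦ Q ⟧ (λ b → G (a ∙ b)))) (sym (⟦⟧-⊗ F Q G)))

⟦⟧-coeffZ : (a : ℕ) (P : Poly) (G : Key → ℚ) →
  ⟦ coeffZ a P ⟧ G ≡ ⟦ P ⟧ (λ k → χ (proj₁ k ℤ.≟ ℤ.+ a) * G (ℤ.+ 0 , proj₂ k))
⟦⟧-coeffZ a [] G = refl
⟦⟧-coeffZ a (t ∷ P) G with ze t ℤ.≟ ℤ.+ a
... | yes _ = cong₂ _+_ (cong (coef t *_) (sym (ℚP.*-identityˡ (G (ℤ.+ 0 , sort (parts t)))))) (⟦⟧-coeffZ a P G)
... | no _ = trans (⟦⟧-coeffZ a P G) (sym (trans (cong (_+ ⟦ P ⟧ G₀)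
  (trans (cong (coef t *_) (ℚP.*-zeroˡ (G (ℤ.+ 0 , sort (parts t))))) (ℚP.*-zeroʳ (coef t)))) (ℚP.+-identityˡ _)))
  where
  G₀ : Key → ℚ
  G₀ k = χ (proj₁ k ℤ.≟ ℤ.+ a) * G (ℤ.+ 0 , proj₂ k)

ZFree : Poly → Set
ZFree P = All (λ t → ze t ≡ ℤ.+ 0) P

⟦⟧-cong-ZFree : {P : Poly} → ZFree P → (G H : Key → ℚ) →
  (∀ μ → G (ℤ.+ 0 , μ) ≡ H (ℤ.+ 0 , μ)) → ⟦ P ⟧ G ≡ ⟦ P ⟧ H
⟦⟧-cong-ZFree [] G H G≗H = refl
⟦⟧-cong-ZFree {t ∷ P} (ze≡0 ∷ zf) G H G≗H = cong₂ _+_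
  (cong (coef t *_) (subst (λ i → G (i , sort (parts t)) ≡ H (i , sort (parts t))) (sym ze≡0) (G≗H (sort (parts t)))))
  (⟦⟧-cong-ZFree zf G H G≗H)

ZFree-⊗ : (P Q : Poly) → ZFree P → ZFree Q → ZFree (P ⊗ Q)
ZFree-⊗ [] Q [] zq = []
ZFree-⊗ (t ∷ P) Q (z ∷ zp) zq = AllP.++⁺ (AllP.map⁺ (All.map (λ z′ → cong₂ ℤ._+_ z z′) zq)) (ZFree-⊗ P Q zp zq)

ZFree-coeffZ : (a : ℕ) (P : Poly) → ZFree (coeffZ a P)
ZFree-coeffZ a [] = []
ZFree-coeffZ a (t ∷ P) with ze t ℤ.≟ ℤ.+ a
... | yes _ = refl ∷ ZFree-coeffZ a P
... | no _ = ZFree-coeffZ a P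

ZFree-zipWith : (is : List ℕ) {hs′ : List Poly} → All ZFree hs′ →
  ZFree (concat (zipWith (λ i h → pw i ⊗ h) is hs′))
ZFree-zipWith [] _ = []
ZFree-zipWith (i ∷ is) [] = []
ZFree-zipWith (i ∷ is) {h ∷ _} (z ∷ zs) = AllP.++⁺ (ZFree-⊗ (pw i) h (refl ∷ []) z) (ZFree-zipWith is zs)

ZFree-hs : (m : ℕ) → All ZFree (hs m)
ZFree-hs zero = (refl ∷ []) ∷ []
ZFree-hs (suc m) =
  ZFree-⊗ (mono (ℤ.+ 1 ℚ./ suc m) (ℤ.+ 0) (ℤ.+ 0)) _ (refl ∷ []) (ZFree-zipWith (map suc (upTo (suc m))) (ZFree-hs m))
  ∷ ZFree-hs m

ZFree-h : (m : ℕ) → ZFree (h m)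
ZFree-h m with hs m | ZFree-hs m
... | _ ∷ _ | z ∷ _ = z
... | [] | [] = []

ZFree-C : (a : ℕ) (F : Poly) → ZFree (C a F)
ZFree-C a F = ZFree-⊗ (mono (sgn (a ∸ 1)) (ℤ.- (ℤ.+ (a ∸ 1))) (ℤ.+ 0)) (coeffZ a X) (refl ∷ []) (ZFree-coeffZ a X)
  where X = pleth F ⊗ genH (a ℕ.+ degBound F)

ZFree-Cs : (α : List ℕ) → ZFree (Cs α one)
ZFree-Cs [] = refl ∷ []
ZFree-Cs (a ∷ α) = ZFree-C a (Cs α one)

⟦⟧-genH : (M : ℕ) (G : Key → ℚ) →
  ⟦ genH M ⟧ G ≡ Σ[ upTo (suc M) ] (λ m → ⟦ h m ⟧ (λ b → G (ℤ.+ m ℤ.+ proj₁ b , proj₂ b)))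
⟦⟧-genH M G = begin
  ⟦ genH M ⟧ G                                 ≡⟨ Σ-concatMap zh (upTo (suc M)) (λ t → coef t * G (key t)) ⟩
  Σ[ upTo (suc M) ] (λ m → ⟦ zh m ⟧ G)         ≡⟨ Σ-cong (upTo (suc M)) {λ m → ⟦ zh m ⟧ G} (λ m →
                                                    trans (⟦⟧-mono⊗ 1ℚ (ℤ.+ 0) (ℤ.+ m) (h m) G) (ℚP.*-identityˡ (hm m))) ⟩
  Σ[ upTo (suc M) ] (λ m → ⟦ h m ⟧ (λ b → G (ℤ.+ m ℤ.+ proj₁ b , proj₂ b))) ∎
  where
  zh : ℕ → Poly
  zh m = mono 1ℚ (ℤ.+ 0) (ℤ.+ m) ⊗ h m
  hm : ℕ → ℚ
  hm m = ⟦ h m ⟧ (λ b → G (ℤ.+ m ℤ.+ proj₁ b , proj₂ b))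

⟦⟧-coeffZ-⊗genH : (a M : ℕ) (F : Poly) → ZFree F → a < suc M → (G : Key → ℚ) →
  ⟦ coeffZ a (F ⊗ genH M) ⟧ G ≡ ⟦ F ⊗ h a ⟧ G
⟦⟧-coeffZ-⊗genH a M F zf a<1+M G = begin
  ⟦ coeffZ a (F ⊗ genH M) ⟧ G                         ≡⟨ ⟦⟧-coeffZ a (F ⊗ genH M) G ⟩
  ⟦ F ⊗ genH M ⟧ G₀                                   ≡⟨ ⟦⟧-⊗ F (genH M) G₀ ⟩
  ⟦ F ⟧ (λ u → ⟦ genH M ⟧ (λ v → G₀ (u ∙ v)))         ≡⟨ ⟦⟧-cong F (λ u → ⟦⟧-genH M (λ v → G₀ (u ∙ v))) ⟩
  ⟦ F ⟧ (λ u → Σ[ upTo (suc M) ] (zPart u))           ≡⟨ ⟦⟧-cong-ZFree zf (λ u → Σ[ upTo (suc M) ] (zPart u)) (hPart a) picks-a ⟩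
  ⟦ F ⟧ (hPart a)                                     ≡⟨ ⟦⟧-⊗ F (h a) G ⟨
  ⟦ F ⊗ h a ⟧ G                                       ∎
  where
  G₀ : Key → ℚ
  G₀ k = χ (proj₁ k ℤ.≟ ℤ.+ a) * G (ℤ.+ 0 , proj₂ k)
  zPart : Key → ℕ → ℚ
  zPart u m = ⟦ h m ⟧ (λ v → G₀ (u ∙ (ℤ.+ m ℤ.+ proj₁ v , proj₂ v)))
  hPart : ℕ → Key → ℚ
  hPart m u = ⟦ h m ⟧ (λ v → G (u ∙ v))
  z-exponent : (μ : List ℕ) (m : ℕ) → zPart (ℤ.+ 0 , μ) m ≡ χ (m ℕ.≟ a) * hPart m (ℤ.+ 0 , μ)
  z-exponent μ m = trans
    (⟦⟧-cong-ZFree (ZFree-h m) (λ v → G₀ ((ℤ.+ 0 , μ) ∙ (ℤ.+ m ℤ.+ proj₁ v , proj₂ v)))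
      (λ v → χ (m ℕ.≟ a) * G ((ℤ.+ 0 , μ) ∙ v)) (λ ν → cong (_* G (ℤ.+ 0 , sort (μ ++ ν)))
        (χ-cong (λ eq → ℤP.+-injective (trans (cong ℤ.+_ (sym (ℕP.+-identityʳ m))) eq))
                (λ eq → cong ℤ.+_ (trans (ℕP.+-identityʳ m) eq)) (ℤ.+ (m ℕ.+ 0) ℤ.≟ ℤ.+ a) (m ℕ.≟ a))))
    (⟦⟧-* (h m) (χ (m ℕ.≟ a)) (λ v → G ((ℤ.+ 0 , μ) ∙ v)))
  picks-a : (μ : List ℕ) → Σ[ upTo (suc M) ] (zPart (ℤ.+ 0 , μ)) ≡ hPart a (ℤ.+ 0 , μ)
  picks-a μ = trans (Σ-cong (upTo (suc M)) (z-exponent μ))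
    (Σ-χ-upTo a (suc M) (λ m → hPart m (ℤ.+ 0 , μ)) a<1+M)

⟦⟧-C : (a : ℕ) (F : Poly) → ZFree F → (G : Key → ℚ) → ⟦ C a F ⟧ G ≡ sgn (a ∸ 1) * ⟦ F ⊗ h a ⟧ G
⟦⟧-C a F zf G = begin
  ⟦ C a F ⟧ G                                ≡⟨ ⟦⟧-mono⊗ (sgn (a ∸ 1)) (ℤ.- (ℤ.+ (a ∸ 1))) (ℤ.+ 0) (coeffZ a X) G ⟩
  sgn (a ∸ 1) * ⟦ coeffZ a X ⟧ G′             ≡⟨ cong (sgn (a ∸ 1) *_) drop-pleth ⟩
  sgn (a ∸ 1) * ⟦ coeffZ a (F ⊗ genH M) ⟧ G  ≡⟨ cong (sgn (a ∸ 1) *_) (⟦⟧-coeffZ-⊗genH a M F zf (s≤s (ℕP.m≤m+n a _)) G) ⟩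
  sgn (a ∸ 1) * ⟦ F ⊗ h a ⟧ G                ∎
  where
  M = a ℕ.+ degBound F
  X = pleth F ⊗ genH M
  G′ : Key → ℚ
  G′ b = G (ℤ.+ 0 ℤ.+ proj₁ b , proj₂ b)
  drop-pleth : ⟦ coeffZ a X ⟧ G′ ≡ ⟦ coeffZ a (F ⊗ genH M) ⟧ G
  drop-pleth = trans (⟦⟧-coeffZ a X G′)
    (trans (⟦⟧-pleth⊗ F (genH M) (λ k → χ (proj₁ k ℤ.≟ ℤ.+ a) * G (ℤ.+ 0 , proj₂ k)))
      (sym (⟦⟧-coeffZ a (F ⊗ genH M) G)))

sgn-+ : (x y : ℕ) → sgn (x ℕ.+ y) ≡ sgn x * sgn y
sgn-+ zero y = sym (ℚP.*-identityˡ _)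
sgn-+ (suc x) y = trans (cong -_ (sgn-+ x y)) (ℚP.neg-distribˡ-* (sgn x) (sgn y))

sgn-*-sgn : (x : ℕ) → sgn x * sgn x ≡ 1ℚ
sgn-*-sgn zero = refl
sgn-*-sgn (suc x) = trans (solve 1 (λ y → (:- y) :* (:- y) := y :* y) refl (sgn x)) (sgn-*-sgn x)

AllPositive : List ℕ → Set
AllPositive = All (1 ℕ.≤_)

sgnα : List ℕ → ℚ
sgnα α = sgn (sum α ∸ length α)

length≤sum : {α : List ℕ} → AllPositive α → length α ℕ.≤ sum α
length≤sum [] = z≤n
length≤sum (1≤a ∷ pos) = ℕP.+-mono-≤ 1≤a (length≤sum pos)

sgnα-∷ : (a : ℕ) {α : List ℕ} → 1 ℕ.≤ a → AllPositive α → sgnα (a ∷ α) ≡ sgn (a ∸ 1) * sgnα α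
sgnα-∷ (suc a) {α} _ pos = trans (cong sgn (ℕP.+-∸-assoc a (length≤sum pos))) (sgn-+ a (sum α ∸ length α))

sgnα-++ : {α β : List ℕ} → AllPositive α → AllPositive β → sgnα (α ++ β) ≡ sgnα α * sgnα β
sgnα-++ {[]} [] _ = sym (ℚP.*-identityˡ _)
sgnα-++ {a ∷ α} {β} (1≤a ∷ posα) posβ = begin
  sgnα (a ∷ α ++ β)               ≡⟨ sgnα-∷ a 1≤a (AllP.++⁺ posα posβ) ⟩
  sgn (a ∸ 1) * sgnα (α ++ β)     ≡⟨ cong (sgn (a ∸ 1) *_) (sgnα-++ posα posβ) ⟩
  sgn (a ∸ 1) * (sgnα α * sgnα β) ≡⟨ ℚP.*-assoc (sgn (a ∸ 1)) (sgnα α) (sgnα β) ⟨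
  sgn (a ∸ 1) * sgnα α * sgnα β   ≡⟨ cong (_* sgnα β) (sgnα-∷ a 1≤a posα) ⟨
  sgnα (a ∷ α) * sgnα β           ∎

⟦⟧-Cs : {α : List ℕ} → AllPositive α → (G : Key → ℚ) → ⟦ Cs α one ⟧ G ≡ sgnα α * ⟦ hProd α ⟧ G
⟦⟧-Cs {[]} [] G = sym (ℚP.*-identityˡ _)
⟦⟧-Cs {a ∷ α} (1≤a ∷ pos) G = begin
  ⟦ C a (Cs α one) ⟧ G                                         ≡⟨ ⟦⟧-C a (Cs α one) (ZFree-Cs α) G ⟩
  sgn (a ∸ 1) * ⟦ Cs α one ⊗ h a ⟧ G                           ≡⟨ cong (sgn (a ∸ 1) *_) (⟦⟧-⊗ (Cs α one) (h a) G) ⟩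
  sgn (a ∸ 1) * ⟦ Cs α one ⟧ Ga                                ≡⟨ cong (sgn (a ∸ 1) *_) (⟦⟧-Cs pos Ga) ⟩
  sgn (a ∸ 1) * (sgnα α * ⟦ hProd α ⟧ Ga)                      ≡⟨ ℚP.*-assoc (sgn (a ∸ 1)) (sgnα α) _ ⟨
  sgn (a ∸ 1) * sgnα α * ⟦ hProd α ⟧ Ga                        ≡⟨ cong₂ _*_ (sgnα-∷ a 1≤a pos) (⟦⟧-⊗ (hProd α) (h a) G) ⟨
  sgnα (a ∷ α) * ⟦ hProd α ⊗ h a ⟧ G                           ≡⟨ cong (sgnα (a ∷ α) *_) (⟦⟧-⊗-comm (hProd α) (h a) G) ⟩
  sgnα (a ∷ α) * ⟦ hProd (a ∷ α) ⟧ G                           ∎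
  where
  Ga : Key → ℚ
  Ga u = ⟦ h a ⟧ (λ v → G (u ∙ v))

⟦⟧-zipWith-hs : (k : ℕ) (f : ℕ → ℕ) (G : Key → ℚ) →
  ⟦ concat (zipWith (λ i h → pw i ⊗ h) (applyUpTo f (suc k)) (hs k)) ⟧ G
    ≡ Σ[ upTo (suc k) ] (λ j → ⟦ pw (f j) ⊗ h (k ∸ j) ⟧ G)
⟦⟧-zipWith-hs zero f G = ⟦⟧-++ (pw (f 0) ⊗ one) [] G
⟦⟧-zipWith-hs (suc k) f G = begin
  ⟦ (pw (f 0) ⊗ h (suc k)) ++ rest ⟧ G                  ≡⟨ ⟦⟧-++ (pw (f 0) ⊗ h (suc k)) rest G ⟩
  ⟦ pw (f 0) ⊗ h (suc k) ⟧ G + ⟦ rest ⟧ G              ≡⟨ cong (⟦ pw (f 0) ⊗ h (suc k) ⟧ G +_) (⟦⟧-zipWith-hs k (λ j → f (suc j)) G) ⟩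
  g 0 + Σ[ upTo (suc k) ] (λ j → g (suc j))             ≡⟨ Σ-upTo-suc (suc k) g ⟨
  Σ[ upTo (suc (suc k)) ] g                             ∎
  where
  rest : Poly
  rest = concat (zipWith (λ i h → pw i ⊗ h) (applyUpTo (λ j → f (suc j)) (suc k)) (hs k))
  g : ℕ → ℚ
  g j = ⟦ pw (f j) ⊗ h (suc k ∸ j) ⟧ G

invSuc : ℕ → ℚ
invSuc m = ℤ.+ 1 ℚ./ suc m

invSuc-nonZero : (m : ℕ) → ℚ.NonZero (invSuc m)
invSuc-nonZero m = ℚP.pos⇒nonZero (invSuc m) {{ℚP.normalize-pos 1 (suc m)}}

sucℚ : ℕ → ℚ
sucℚ m = (ℚ.1/ invSuc m) {{invSuc-nonZero m}}

0≤sucℚ : (m : ℕ) → 0ℚ ≤ sucℚ m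
0≤sucℚ m = ℚP.<⇒≤ (ℚP.positive⁻¹ (sucℚ m) {{ℚP.1/pos⇒pos (invSuc m) {{ℚP.normalize-pos 1 (suc m)}}}})

-- sucℚ m = m + 1 inverts the factor 1/(m + 1) in the definition of hs, which is Newton's identity
-- (m + 1) h_{m+1} = Σ_{j ≤ m} p_{j+1} h_{m−j}; the proof just unfolds that definition.
newton : (m : ℕ) (G : Key → ℚ) →
  sucℚ m * ⟦ h (suc m) ⟧ G ≡ Σ[ upTo (suc m) ] (λ j → ⟦ pw (suc j) ⊗ h (m ∸ j) ⟧ G)
newton m G = begin
  sucℚ m * ⟦ h (suc m) ⟧ G                ≡⟨ cong (sucℚ m *_) (⟦⟧-scale (invSuc m) N G) ⟩
  sucℚ m * (invSuc m * ⟦ N ⟧ G)           ≡⟨ ℚP.*-assoc (sucℚ m) (invSuc m) _ ⟨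
  sucℚ m * invSuc m * ⟦ N ⟧ G             ≡⟨ cong (_* ⟦ N ⟧ G) (ℚP.*-inverseˡ (invSuc m) {{invSuc-nonZero m}}) ⟩
  1ℚ * ⟦ N ⟧ G                            ≡⟨ ℚP.*-identityˡ _ ⟩
  ⟦ N ⟧ G                                 ≡⟨ cong (λ is → ⟦ concat (zipWith (λ i h → pw i ⊗ h) is (hs m)) ⟧ G) (LP.map-upTo suc (suc m)) ⟩
  ⟦ concat (zipWith (λ i h → pw i ⊗ h) (applyUpTo suc (suc m)) (hs m)) ⟧ G ≡⟨ ⟦⟧-zipWith-hs m suc G ⟩
  Σ[ upTo (suc m) ] (λ j → ⟦ pw (suc j) ⊗ h (m ∸ j) ⟧ G) ∎
  where
  N : Poly
  N = concat (zipWith (λ i h → pw i ⊗ h) (map suc (upTo (suc m))) (hs m))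

⟦⟧-hProd-++ : (α β : List ℕ) (G : Key → ℚ) → ⟦ hProd (α ++ β) ⟧ G ≡ ⟦ hProd α ⊗ hProd β ⟧ G
⟦⟧-hProd-++ [] β G = sym (⟦⟧-one⊗ (hProd β) G)
⟦⟧-hProd-++ (a ∷ α) β G = begin
  ⟦ h a ⊗ hProd (α ++ β) ⟧ G                              ≡⟨ ⟦⟧-⊗ (h a) (hProd (α ++ β)) G ⟩
  ⟦ h a ⟧ (λ u → ⟦ hProd (α ++ β) ⟧ (λ v → G (u ∙ v)))    ≡⟨ ⟦⟧-cong (h a) (λ u → ⟦⟧-hProd-++ α β (λ v → G (u ∙ v))) ⟩
  ⟦ h a ⟧ (λ u → ⟦ hProd α ⊗ hProd β ⟧ (λ v → G (u ∙ v))) ≡⟨ ⟦⟧-⊗ (h a) (hProd α ⊗ hProd β) G ⟨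
  ⟦ h a ⊗ (hProd α ⊗ hProd β) ⟧ G                         ≡⟨ ⟦⟧-⊗-assoc (h a) (hProd α) (hProd β) G ⟨
  ⟦ (h a ⊗ hProd α) ⊗ hProd β ⟧ G                         ∎

hTerm : List ℕ → (Key → ℚ) → ℚ
hTerm α G = sgnα α * ⟦ hProd α ⟧ G

hTerm-++ : {α β : List ℕ} → AllPositive α → AllPositive β → (G : Key → ℚ) →
  hTerm (α ++ β) G ≡ sgnα α * sgnα β * ⟦ hProd α ⟧ (λ u → ⟦ hProd β ⟧ (λ v → G (u ∙ v)))
hTerm-++ {α} {β} posα posβ G = cong₂ _*_ (sgnα-++ posα posβ)
  (trans (⟦⟧-hProd-++ α β G) (⟦⟧-⊗ (hProd α) (hProd β) G))

Combination : Set
Combination = List (ℚ × List ℕ)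

⟦_⟧ᶜ : Combination → (Key → ℚ) → ℚ
⟦ L ⟧ᶜ G = Σ[ L ] (λ p → proj₁ p * hTerm (proj₂ p) G)

IsComposition : ℕ → List ℕ → Set
IsComposition n α = AllPositive α × sum α ≡ n

IsNonNegComb : ℕ → Combination → Set
IsNonNegComb n = All (λ p → 0ℚ ≤ proj₁ p × IsComposition n (proj₂ p))

_⋆_ : Combination → Combination → Combination
L ⋆ L′ = concatMap (λ p → map (λ p′ → proj₁ p * proj₁ p′ , proj₂ p ++ proj₂ p′) L′) L

IsNonNegComb-⋆ : {m k : ℕ} {L L′ : Combination} → IsNonNegComb m L → IsNonNegComb k L′ → IsNonNegComb (m ℕ.+ k) (L ⋆ L′)
IsNonNegComb-⋆ nnL nnL′ = AllP.concat⁺ (AllP.map⁺ (All.map (λ { {c , α} (0≤c , posα , Σα) →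
  AllP.map⁺ (All.map (λ { {c′ , α′} (0≤c′ , posα′ , Σα′) →
    0≤* 0≤c 0≤c′ , AllP.++⁺ posα posα′ , trans (ℕLP.sum-++ α α′) (cong₂ ℕ._+_ Σα Σα′) }) nnL′) }) nnL))

⟦⟧ᶜ-⋆ : {m k : ℕ} {L L′ : Combination} → IsNonNegComb m L → IsNonNegComb k L′ → (G : Key → ℚ) →
  ⟦ L ⋆ L′ ⟧ᶜ G ≡ ⟦ L ⟧ᶜ (λ u → ⟦ L′ ⟧ᶜ (λ v → G (u ∙ v)))
⟦⟧ᶜ-⋆ {L = L} {L′} nnL nnL′ G = begin
  ⟦ L ⋆ L′ ⟧ᶜ G
    ≡⟨ Σ-concatMap (λ p → map (mul p) L′) L value ⟩
  Σ[ L ] (λ p → Σ[ map (mul p) L′ ] value)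
    ≡⟨ Σ-cong L (λ p → Σ-map (mul p) L′ value) ⟩
  Σ[ L ] (λ p → Σ[ L′ ] (λ p′ → value (mul p p′)))
    ≡⟨ Σ-cong-All (All.map (λ {p} nnp → Σ-cong-All (All.map (λ {p′} nnp′ →
         cross {p} {p′} (proj₁ (proj₂ nnp)) (proj₁ (proj₂ nnp′))) nnL′)) nnL) ⟩
  Σ[ L ] (λ p → Σ[ L′ ] (λ p′ → proj₁ p * (sgnα (proj₂ p) * inner p p′)))
    ≡⟨ Σ-cong L (λ p → trans (cong (proj₁ p *_) (*-distribˡ-Σ (sgnα (proj₂ p)) L′ (inner p)))
                         (*-distribˡ-Σ (proj₁ p) L′ (λ p′ → sgnα (proj₂ p) * inner p p′))) ⟨
  Σ[ L ] (λ p → proj₁ p * (sgnα (proj₂ p) * Σ[ L′ ] (inner p)))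
    ≡⟨ Σ-cong L (λ p → cong (λ x → proj₁ p * (sgnα (proj₂ p) * x)) (⟦⟧-hProd-⟦⟧ᶜ p)) ⟨
  ⟦ L ⟧ᶜ (λ u → ⟦ L′ ⟧ᶜ (λ v → G (u ∙ v)))
    ∎
  where
  mul : ℚ × List ℕ → ℚ × List ℕ → ℚ × List ℕ
  mul p p′ = proj₁ p * proj₁ p′ , proj₂ p ++ proj₂ p′
  value : ℚ × List ℕ → ℚ
  value p = proj₁ p * hTerm (proj₂ p) G
  T : ℚ × List ℕ → ℚ × List ℕ → ℚ
  T p p′ = ⟦ hProd (proj₂ p) ⟧ (λ u → ⟦ hProd (proj₂ p′) ⟧ (λ v → G (u ∙ v)))
  inner : ℚ × List ℕ → ℚ × List ℕ → ℚ
  inner p p′ = proj₁ p′ * (sgnα (proj₂ p′) * T p p′)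
  cross : {p p′ : ℚ × List ℕ} → AllPositive (proj₂ p) → AllPositive (proj₂ p′) →
    value (mul p p′) ≡ proj₁ p * (sgnα (proj₂ p) * inner p p′)
  cross {c , α} {c′ , α′} posα posα′ = trans (cong (c * c′ *_) (hTerm-++ posα posα′ G))
    (solve 5 (λ c c′ s s′ t → c :* c′ :* (s :* s′ :* t) := c :* (s :* (c′ :* (s′ :* t))))
      refl c c′ (sgnα α) (sgnα α′) (T (c , α) (c′ , α′)))
  ⟦⟧-hProd-⟦⟧ᶜ : (p : ℚ × List ℕ) → ⟦ hProd (proj₂ p) ⟧ (λ u → ⟦ L′ ⟧ᶜ (λ v → G (u ∙ v))) ≡ Σ[ L′ ] (inner p)
  ⟦⟧-hProd-⟦⟧ᶜ (c , α) = trans (⟦⟧-Σ (hProd α) L′ (λ p′ u → proj₁ p′ * hTerm (proj₂ p′) (λ v → G (u ∙ v))))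
    (Σ-cong L′ (λ p′ → trans (⟦⟧-* (hProd α) (proj₁ p′) (λ u → hTerm (proj₂ p′) (λ v → G (u ∙ v))))
      (cong (proj₁ p′ *_) (⟦⟧-* (hProd α) (sgnα (proj₂ p′)) (λ u → ⟦ hProd (proj₂ p′) ⟧ (λ v → G (u ∙ v)))))))

⟦⟧ᶜ-cong : (L : Combination) {G H : Key → ℚ} → (∀ k → G k ≡ H k) → ⟦ L ⟧ᶜ G ≡ ⟦ L ⟧ᶜ H
⟦⟧ᶜ-cong L G≗H = Σ-cong L (λ p → cong (λ x → proj₁ p * (sgnα (proj₂ p) * x)) (⟦⟧-cong (hProd (proj₂ p)) G≗H))

Expansion : ℕ → ((Key → ℚ) → ℚ) → Set
Expansion n A = ∃ λ L → IsNonNegComb n L × (∀ G → A G ≡ ⟦ L ⟧ᶜ G)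

Expansion-cong : {n : ℕ} {A B : (Key → ℚ) → ℚ} → (∀ G → A G ≡ B G) → Expansion n A → Expansion n B
Expansion-cong A≗B (L , nn , rep) = L , nn , λ G → trans (sym (A≗B G)) (rep G)

Expansion-hTerm : {n : ℕ} {α : List ℕ} → IsComposition n α → Expansion n (hTerm α)
Expansion-hTerm {α = α} comp = (1ℚ , α) ∷ [] , (0≤1 , comp) ∷ [] ,
  λ G → sym (trans (ℚP.+-identityʳ _) (ℚP.*-identityˡ _))

Expansion-* : {n : ℕ} {c : ℚ} {A : (Key → ℚ) → ℚ} → 0ℚ ≤ c → Expansion n A → Expansion n (λ G → c * A G)
Expansion-* {c = c} {A} 0≤c (L , nn , rep) = map (λ p → c * proj₁ p , proj₂ p) L ,
  AllP.map⁺ (All.map (λ { (0≤d , comp) → 0≤* 0≤c 0≤d , comp }) nn) ,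
  λ G → begin
    c * A G             ≡⟨ cong (c *_) (rep G) ⟩
    c * ⟦ L ⟧ᶜ G         ≡⟨ *-distribˡ-Σ c L (λ p → proj₁ p * hTerm (proj₂ p) G) ⟩
    Σ[ L ] (λ p → c * (proj₁ p * hTerm (proj₂ p) G))
                        ≡⟨ Σ-cong L (λ p → ℚP.*-assoc c (proj₁ p) (hTerm (proj₂ p) G)) ⟨
    Σ[ L ] (λ p → c * proj₁ p * hTerm (proj₂ p) G)
                        ≡⟨ Σ-map (λ p → c * proj₁ p , proj₂ p) L (λ p → proj₁ p * hTerm (proj₂ p) G) ⟨
    ⟦ map (λ p → c * proj₁ p , proj₂ p) L ⟧ᶜ G ∎

Expansion-+ : {n : ℕ} {A B : (Key → ℚ) → ℚ} → Expansion n A → Expansion n B → Expansion n (λ G → A G + B G)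
Expansion-+ (L , nn , rep) (L′ , nn′ , rep′) = L ++ L′ , AllP.++⁺ nn nn′ ,
  λ G → trans (cong₂ _+_ (rep G) (rep′ G)) (sym (Σ-++ L L′ (λ p → proj₁ p * hTerm (proj₂ p) G)))

Expansion-Σ : {n : ℕ} {X : Set} (xs : List X) {A : X → (Key → ℚ) → ℚ} →
  All (λ x → Expansion n (A x)) xs → Expansion n (λ G → Σ[ xs ] (λ x → A x G))
Expansion-Σ [] [] = [] , [] , λ G → refl
Expansion-Σ (x ∷ xs) (exp ∷ exps) = Expansion-+ exp (Expansion-Σ xs exps)

Expansion-∙ : {m k : ℕ} {A B : (Key → ℚ) → ℚ} → Expansion m A → Expansion k B →
  Expansion (m ℕ.+ k) (λ G → A (λ u → B (λ v → G (u ∙ v))))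
Expansion-∙ {A = A} {B} (L , nn , rep) (L′ , nn′ , rep′) = L ⋆ L′ , IsNonNegComb-⋆ nn nn′ , λ G → begin
  A (λ u → B (λ v → G (u ∙ v)))            ≡⟨ rep (λ u → B (λ v → G (u ∙ v))) ⟩
  ⟦ L ⟧ᶜ (λ u → B (λ v → G (u ∙ v)))       ≡⟨ ⟦⟧ᶜ-cong L (λ u → rep′ (λ v → G (u ∙ v))) ⟩
  ⟦ L ⟧ᶜ (λ u → ⟦ L′ ⟧ᶜ (λ v → G (u ∙ v))) ≡⟨ ⟦⟧ᶜ-⋆ nn nn′ G ⟨
  ⟦ L ⋆ L′ ⟧ᶜ G                            ∎

Expansion-⊗ : {m k : ℕ} (P Q : Poly) → Expansion m ⟦ P ⟧ → Expansion k ⟦ Q ⟧ → Expansion (m ℕ.+ k) ⟦ P ⊗ Q ⟧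
Expansion-⊗ P Q expP expQ = Expansion-cong (λ G → sym (⟦⟧-⊗ P Q G)) (Expansion-∙ expP expQ)

sgn-split : (m j : ℕ) → j < m → sgn j * sgn (m ∸ j ∸ 1) ≡ - sgn m
sgn-split (suc m) j (s≤s j≤m) = begin
  sgn j * sgn (suc m ∸ j ∸ 1) ≡⟨ cong (λ i → sgn j * sgn (i ∸ 1)) (ℕP.+-∸-assoc 1 j≤m) ⟩
  sgn j * sgn (m ∸ j)         ≡⟨ sgn-+ j (m ∸ j) ⟨
  sgn (j ℕ.+ (m ∸ j))         ≡⟨ cong sgn (ℕP.m+[n∸m]≡n j≤m) ⟩
  sgn m                       ≡⟨ solve 1 (λ x → x := :- (:- x)) refl (sgn m) ⟩
  - sgn (suc m)               ∎

⟦⟧-signed-h : (k : ℕ) (G : Key → ℚ) → ⟦ scale (sgn (k ∸ 1)) (h k) ⟧ G ≡ hTerm [ k ] G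
⟦⟧-signed-h k G = trans (⟦⟧-scale (sgn (k ∸ 1)) (h k) G)
  (cong₂ _*_ (cong (λ i → sgn (i ∸ 1)) (sym (ℕP.+-identityʳ k))) (sym (⟦⟧-⊗one (h k) G)))

newton-signed : (m : ℕ) (G : Key → ℚ) →
  ⟦ scale (sgn m) (pw (suc m)) ⟧ G
    ≡ sucℚ m * hTerm [ suc m ] G
      + Σ[ upTo m ] (λ j → ⟦ scale (sgn j) (pw (suc j)) ⊗ scale (sgn (m ∸ j ∸ 1)) (h (m ∸ j)) ⟧ G)
newton-signed m G = begin
  ⟦ scale s (pw (suc m)) ⟧ G                     ≡⟨ ⟦⟧-scale s (pw (suc m)) G ⟩
  s * X                                          ≡⟨ solve 3 (λ s X ΣT → s :* X := s :* (ΣT :+ X) :+ (:- s) :* ΣT) refl s X ΣT ⟩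
  s * (ΣT + X) + - s * ΣT                        ≡⟨ cong₂ (λ x y → s * x + y) (sym newton-split) (*-distribˡ-Σ (- s) (upTo m) T) ⟩
  s * (sucℚ m * H) + Σ[ upTo m ] (λ j → - s * T j)
                                                 ≡⟨ cong₂ _+_ (solve 3 (λ s c H → s :* (c :* H) := c :* (s :* H)) refl s (sucℚ m) H)
                                                      (Σ-cong-All (All.map (λ {j} → signed-summand j) (AllP.all-upTo m))) ⟩
  sucℚ m * (s * H) + Σ[ upTo m ] Z              ≡⟨ cong (λ x → sucℚ m * x + Σ[ upTo m ] Z) (trans (sym (⟦⟧-scale s (h (suc m)) G)) (⟦⟧-signed-h (suc m) G)) ⟩
  sucℚ m * hTerm [ suc m ] G + Σ[ upTo m ] Z    ∎
  where
  s X H : ℚ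
  s = sgn m
  X = ⟦ pw (suc m) ⟧ G
  H = ⟦ h (suc m) ⟧ G
  T Z : ℕ → ℚ
  T j = ⟦ pw (suc j) ⊗ h (m ∸ j) ⟧ G
  Z j = ⟦ scale (sgn j) (pw (suc j)) ⊗ scale (sgn (m ∸ j ∸ 1)) (h (m ∸ j)) ⟧ G
  ΣT : ℚ
  ΣT = Σ[ upTo m ] T
  newton-split : sucℚ m * H ≡ ΣT + X
  newton-split = begin
    sucℚ m * H   ≡⟨ newton m G ⟩
    Σ[ upTo (suc m) ] T ≡⟨ Σ-upTo-∷ʳ m T ⟩
    ΣT + T m     ≡⟨ cong (ΣT +_) (trans (cong (λ i → ⟦ pw (suc m) ⊗ h i ⟧ G) (ℕP.n∸n≡0 m)) (⟦⟧-⊗one (pw (suc m)) G)) ⟩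
    ΣT + X       ∎
  signed-summand : (j : ℕ) → j < m → - s * T j ≡ Z j
  signed-summand j j<m = sym (begin
    Z j                                 ≡⟨ ⟦⟧-scale⊗ (sgn j) (pw (suc j)) (scale (sgn (m ∸ j ∸ 1)) (h (m ∸ j))) G ⟩
    sgn j * ⟦ pw (suc j) ⊗ scale (sgn (m ∸ j ∸ 1)) (h (m ∸ j)) ⟧ G
                                        ≡⟨ cong (sgn j *_) (⟦⟧-⊗scale (sgn (m ∸ j ∸ 1)) (pw (suc j)) (h (m ∸ j)) G) ⟩
    sgn j * (sgn (m ∸ j ∸ 1) * T j)     ≡⟨ ℚP.*-assoc (sgn j) (sgn (m ∸ j ∸ 1)) (T j) ⟨
    sgn j * sgn (m ∸ j ∸ 1) * T j       ≡⟨ cong (_* T j) (sgn-split m j j<m) ⟩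
    - s * T j                           ∎)

Expansion-signed-h : (k : ℕ) → 1 ℕ.≤ k → Expansion k ⟦ scale (sgn (k ∸ 1)) (h k) ⟧
Expansion-signed-h k 1≤k = Expansion-cong (λ G → sym (⟦⟧-signed-h k G))
  (Expansion-hTerm ((1≤k ∷ []) , ℕP.+-identityʳ k))

Expansion-signed-pw : (m : ℕ) → Expansion (suc m) ⟦ scale (sgn m) (pw (suc m)) ⟧
Expansion-signed-pw = <-rec (λ m → Expansion (suc m) ⟦ scale (sgn m) (pw (suc m)) ⟧) step
  where
  step : (m : ℕ) → (∀ {j} → j < m → Expansion (suc j) ⟦ scale (sgn j) (pw (suc j)) ⟧) →
    Expansion (suc m) ⟦ scale (sgn m) (pw (suc m)) ⟧
  step m IH = Expansion-cong (λ G → sym (newton-signed m G))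
    (Expansion-+ (Expansion-* (0≤sucℚ m) (Expansion-hTerm ((s≤s z≤n ∷ []) , ℕP.+-identityʳ (suc m))))
                 (Expansion-Σ (upTo m) (All.map summand (AllP.all-upTo m))))
    where
    summand : {j : ℕ} → j < m →
      Expansion (suc m) ⟦ scale (sgn j) (pw (suc j)) ⊗ scale (sgn (m ∸ j ∸ 1)) (h (m ∸ j)) ⟧
    summand {j} j<m = subst (λ n → Expansion n ⟦ P ⊗ Q ⟧) (cong suc (ℕP.m+[n∸m]≡n (ℕP.<⇒≤ j<m)))
      (Expansion-⊗ P Q (IH j<m) (Expansion-signed-h (m ∸ j) (ℕP.m<n⇒0<n∸m j<m)))
      where
      P Q : Poly
      P = scale (sgn j) (pw (suc j))
      Q = scale (sgn (m ∸ j ∸ 1)) (h (m ∸ j))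

ωp : List ℕ → (Key → ℚ) → ℚ
ωp μ G = sgnα μ * G (ℤ.+ 0 , sort μ)

Expansion-ωp : {μ : List ℕ} → AllPositive μ → Expansion (sum μ) (ωp μ)
Expansion-ωp {[]} [] = Expansion-cong (λ G → cong (1ℚ *_) (⟦⟧-one G)) (Expansion-hTerm ([] , refl))
Expansion-ωp {suc k ∷ μ} (1≤k ∷ pos) = Expansion-cong ωp-∷ (Expansion-∙ (Expansion-signed-pw k) (Expansion-ωp pos))
  where
  ωp-∷ : (G : Key → ℚ) → ⟦ scale (sgn k) (pw (suc k)) ⟧ (λ u → ωp μ (λ v → G (u ∙ v))) ≡ ωp (suc k ∷ μ) G
  ωp-∷ G = begin
    ⟦ scale (sgn k) (pw (suc k)) ⟧ (λ u → ωp μ (λ v → G (u ∙ v)))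
      ≡⟨ ⟦⟧-scale (sgn k) (pw (suc k)) (λ u → ωp μ (λ v → G (u ∙ v))) ⟩
    sgn k * ⟦ pw (suc k) ⟧ (λ u → ωp μ (λ v → G (u ∙ v)))
      ≡⟨ cong (sgn k *_) (⟦⟧-pw (suc k) (λ u → ωp μ (λ v → G (u ∙ v)))) ⟩
    sgn k * (sgnα μ * G (ℤ.+ 0 , sort (suc k ∷ sort μ)))
      ≡⟨ ℚP.*-assoc (sgn k) (sgnα μ) (G (ℤ.+ 0 , sort (suc k ∷ sort μ))) ⟨
    sgn k * sgnα μ * G (ℤ.+ 0 , sort (suc k ∷ sort μ))
      ≡⟨ cong₂ _*_ (sym (sgnα-∷ (suc k) 1≤k pos)) (cong (λ ν → G (ℤ.+ 0 , ν)) (sort-cong-↭ (prep (suc k) (sort-↭ μ)))) ⟩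
    ωp (suc k ∷ μ) G
      ∎

comps-sound : (n : ℕ) → All (IsComposition n) (comps n)
comps-sound zero = ([] , refl) ∷ []
comps-sound (suc n) = AllP.++⁺
  (AllP.map⁺ (All.map (λ { (pos , Σα) → s≤s z≤n ∷ pos , cong suc Σα }) (comps-sound n)))
  (AllP.concat⁺ (AllP.map⁺ (All.map (λ { {[]} _ → [] ; {a ∷ α} (_ ∷ pos , Σα) → (s≤s z≤n ∷ pos , cong suc Σα) ∷ [] })
    (comps-sound n))))

onBumpedHead : (List ℕ → ℚ) → List ℕ → ℚ
onBumpedHead g [] = 0ℚ
onBumpedHead g (a ∷ α) = g (suc a ∷ α)

Σ-comps-suc : (n : ℕ) (g : List ℕ → ℚ) →
  Σ[ comps (suc n) ] g ≡ Σ[ comps n ] (λ α → g (1 ∷ α)) + Σ[ comps n ] (onBumpedHead g)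
Σ-comps-suc n g = trans (Σ-++ (map (1 ∷_) (comps n)) _ g)
  (cong₂ _+_ (Σ-map (1 ∷_) (comps n) g)
    (Σ-concatMap-cong _ (comps n) g (onBumpedHead g) λ { [] → refl ; (a ∷ α) → ℚP.+-identityʳ (g (suc a ∷ α)) }))

Σ-comps-δ-≢ : (n : ℕ) (β : List ℕ) → sum β ≢ n → (f : List ℕ → ℚ) → Σ[ comps n ] (λ α → δ β α * f α) ≡ 0ℚ
Σ-comps-δ-≢ n β Σβ≢n f = trans
  (Σ-cong-All (All.map (λ {α} comp → χ-*-no (λ β≡α → Σβ≢n (trans (cong sum β≡α) (proj₂ comp))) (LP.≡-dec ℕ._≟_ β α) (f α))
    (comps-sound n)))
  (Σ-zero (comps n))

Σ-comps-δ : (n : ℕ) (β : List ℕ) → IsComposition n β → (f : List ℕ → ℚ) → Σ[ comps n ] (λ α → δ β α * f α) ≡ f β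
Σ-comps-δ zero [] _ f = trans (ℚP.+-identityʳ _) (ℚP.*-identityˡ (f []))
Σ-comps-δ zero (suc a ∷ β) (_ , ()) f
Σ-comps-δ (suc n) [] (_ , ()) f
Σ-comps-δ _ (zero ∷ β) (() ∷ _ , _) f
Σ-comps-δ (suc n) (suc zero ∷ β) (_ ∷ pos , Σβ) f = begin
  Σ[ comps (suc n) ] g                                              ≡⟨ Σ-comps-suc n g ⟩
  Σ[ comps n ] (λ α → g (1 ∷ α)) + Σ[ comps n ] (onBumpedHead g)    ≡⟨ cong₂ _+_ tail-sum bumped-sum ⟩
  f (1 ∷ β) + 0ℚ                                                    ≡⟨ ℚP.+-identityʳ _ ⟩
  f (1 ∷ β)                                                         ∎
  where
  g : List ℕ → ℚ
  g α = δ (1 ∷ β) α * f α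
  tail-sum : Σ[ comps n ] (λ α → g (1 ∷ α)) ≡ f (1 ∷ β)
  tail-sum = trans (Σ-cong (comps n) (λ α → cong (_* f (1 ∷ α))
      (χ-cong LP.∷-injectiveʳ (cong (1 ∷_)) (LP.≡-dec ℕ._≟_ (1 ∷ β) (1 ∷ α)) (LP.≡-dec ℕ._≟_ β α))))
    (Σ-comps-δ n β (pos , ℕP.suc-injective Σβ) (λ α → f (1 ∷ α)))
  no-bump : {α : List ℕ} → IsComposition n α → onBumpedHead g α ≡ 0ℚ
  no-bump {[]} _ = refl
  no-bump {a ∷ α} (1≤a ∷ _ , _) = χ-*-no (λ eq → ℕP.<⇒≢ 1≤a (ℕP.suc-injective (LP.∷-injectiveˡ eq)))
    (LP.≡-dec ℕ._≟_ (1 ∷ β) (suc a ∷ α)) (f (suc a ∷ α))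
  bumped-sum : Σ[ comps n ] (onBumpedHead g) ≡ 0ℚ
  bumped-sum = trans (Σ-cong-All (All.map no-bump (comps-sound n))) (Σ-zero (comps n))
Σ-comps-δ (suc n) (suc (suc a) ∷ β) (_ ∷ pos , Σβ) f = begin
  Σ[ comps (suc n) ] g                                              ≡⟨ Σ-comps-suc n g ⟩
  Σ[ comps n ] (λ α → g (1 ∷ α)) + Σ[ comps n ] (onBumpedHead g)    ≡⟨ cong₂ _+_ tail-sum bumped-sum ⟩
  0ℚ + f (suc (suc a) ∷ β)                                          ≡⟨ ℚP.+-identityˡ _ ⟩
  f (suc (suc a) ∷ β)                                               ∎
  where
  g : List ℕ → ℚ
  g α = δ (suc (suc a) ∷ β) α * f α
  tail-sum : Σ[ comps n ] (λ α → g (1 ∷ α)) ≡ 0ℚ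
  tail-sum = trans (Σ-cong (comps n) (λ α →
      χ-*-no (λ eq → ℕP.1+n≢0 (ℕP.suc-injective (LP.∷-injectiveˡ eq))) (LP.≡-dec ℕ._≟_ (suc (suc a) ∷ β) (1 ∷ α)) (f (1 ∷ α))))
    (Σ-zero (comps n))
  f-bumped : List ℕ → ℚ
  f-bumped [] = f []
  f-bumped (b ∷ α) = f (suc b ∷ α)
  bump : (α : List ℕ) → onBumpedHead g α ≡ δ (suc a ∷ β) α * f-bumped α
  bump [] = sym (χ-*-no (λ ()) (LP.≡-dec ℕ._≟_ (suc a ∷ β) []) (f []))
  bump (b ∷ α) = cong (_* f (suc b ∷ α)) (χ-cong
    (λ eq → cong₂ _∷_ (ℕP.suc-injective (LP.∷-injectiveˡ eq)) (LP.∷-injectiveʳ eq))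
    (λ eq → cong₂ _∷_ (cong suc (LP.∷-injectiveˡ eq)) (LP.∷-injectiveʳ eq))
    (LP.≡-dec ℕ._≟_ (suc (suc a) ∷ β) (suc b ∷ α)) (LP.≡-dec ℕ._≟_ (suc a ∷ β) (b ∷ α)))
  bumped-sum : Σ[ comps n ] (onBumpedHead g) ≡ f (suc (suc a) ∷ β)
  bumped-sum = trans (Σ-cong (comps n) bump) (Σ-comps-δ n (suc a ∷ β) (s≤s z≤n ∷ pos , ℕP.suc-injective Σβ) f-bumped)

coefficientOf : Combination → List ℕ → ℚ
coefficientOf L α = Σ[ L ] (λ p → δ (proj₂ p) α * proj₁ p)

0≤coefficientOf : {n : ℕ} {L : Combination} → IsNonNegComb n L → (α : List ℕ) → 0ℚ ≤ coefficientOf L α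
0≤coefficientOf nn α = Σ-nonNeg (All.map (λ {p} nnp → 0≤* (0≤χ (LP.≡-dec ℕ._≟_ (proj₂ p) α)) (proj₁ nnp)) nn)

⟦⟧ᶜ-collect : {n : ℕ} {L : Combination} → IsNonNegComb n L → (G : Key → ℚ) →
  ⟦ L ⟧ᶜ G ≡ Σ[ comps n ] (λ α → coefficientOf L α * hTerm α G)
⟦⟧ᶜ-collect {n} {L} nn G = sym (begin
  Σ[ comps n ] (λ α → coefficientOf L α * hTerm α G)
    ≡⟨ Σ-cong (comps n) (λ α → *-distribʳ-Σ (hTerm α G) L (λ p → δ (proj₂ p) α * proj₁ p)) ⟩
  Σ[ comps n ] (λ α → Σ[ L ] (λ p → δ (proj₂ p) α * proj₁ p * hTerm α G))
    ≡⟨ Σ-comm (comps n) L (λ α p → δ (proj₂ p) α * proj₁ p * hTerm α G) ⟩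
  Σ[ L ] (λ p → Σ[ comps n ] (λ α → δ (proj₂ p) α * proj₁ p * hTerm α G))
    ≡⟨ Σ-cong-All (All.map (λ {p} nnp → trans
         (Σ-cong (comps n) (λ α → ℚP.*-assoc (δ (proj₂ p) α) (proj₁ p) (hTerm α G)))
         (Σ-comps-δ n (proj₂ p) (proj₂ nnp) (λ α → proj₁ p * hTerm α G))) nn) ⟩
  ⟦ L ⟧ᶜ G
    ∎)

Expansion-Σ-ωp : (n : ℕ) (w : List ℕ → ℚ) → (∀ α → 0ℚ ≤ w α) →
  Expansion n (λ G → Σ[ comps n ] (λ α → w α * ωp α G))
Expansion-Σ-ωp n w 0≤w = Expansion-Σ (comps n) (All.map (λ {α} (pos , Σα≡n) →
  subst (λ m → Expansion m (λ G → w α * ωp α G)) Σα≡n (Expansion-* (0≤w α) (Expansion-ωp pos))) (comps-sound n))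

coeffWeight : List ℕ → Key → ℚ
coeffWeight μ k = δ (proj₂ k) μ

coeffQ1-⟦⟧ : (P : Poly) (μ : List ℕ) → coeffQ1 P μ ≡ ⟦ P ⟧ (coeffWeight μ)
coeffQ1-⟦⟧ [] μ = refl
coeffQ1-⟦⟧ (t ∷ P) μ with LP.≡-dec ℕ._≟_ (sort (parts t)) μ
... | yes _ = cong₂ _+_ (sym (ℚP.*-identityʳ (coef t))) (coeffQ1-⟦⟧ P μ)
... | no _ = trans (coeffQ1-⟦⟧ P μ)
  (sym (trans (cong (_+ ⟦ P ⟧ (coeffWeight μ)) (ℚP.*-zeroʳ (coef t))) (ℚP.+-identityˡ _)))

coeffQ1-Cs : {n : ℕ} {α : List ℕ} → IsComposition n α → (μ : List ℕ) →
  coeffQ1 (Cs α one) μ ≡ sgn (n ∸ length α) * coeffQ1 (hProd α) μ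
coeffQ1-Cs {α = α} (pos , refl) μ = trans (coeffQ1-⟦⟧ (Cs α one) μ)
  (trans (⟦⟧-Cs pos (coeffWeight μ)) (cong (sgnα α *_) (sym (coeffQ1-⟦⟧ (hProd α) μ))))

module _ {n : ℕ} {F : List ℕ → ℚ} (supp : ∀ μ → F μ ≢ 0ℚ → IsPartition μ × sum μ ≡ n) where

  F-vanishes : (μ : List ℕ) → ¬ (IsPartition μ × sum μ ≡ n) → F μ ≡ 0ℚ
  F-vanishes μ ¬supp with F μ ℚP.≟ 0ℚ
  ... | yes Fμ≡0 = Fμ≡0
  ... | no Fμ≢0 = ⊥-elim (¬supp (supp μ Fμ≢0))

  ω-nonNeg : (∀ μ → IsPartition μ → 0ℚ ≤ ω F μ) → (μ : List ℕ) → 0ℚ ≤ ω F μ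
  ω-nonNeg 0≤ωF μ with F μ ℚP.≟ 0ℚ
  ... | yes Fμ≡0 = ℚP.≤-reflexive (sym (trans (cong (sgn (sum μ ∸ length μ) *_) Fμ≡0) (ℚP.*-zeroʳ (sgn (sum μ ∸ length μ)))))
  ... | no Fμ≢0 = 0≤ωF μ (proj₁ (supp μ Fμ≢0))

  -- F = Σ_α (ωF)(α) ω(p_α), read off at the coefficient of p_ν.
  Σ-ω-ωp : (ν : List ℕ) → AllPositive ν → Σ[ comps n ] (λ α → ω F α * ωp α (coeffWeight ν)) ≡ F ν
  Σ-ω-ωp ν pos = trans (Σ-cong (comps n) summand) (picks-ν (sum ν ℕ.≟ n))
    where
    sorted-support : (α : List ℕ) → F α * δ (sort α) ν ≡ δ ν α * F α
    sorted-support α with F α ℚP.≟ 0ℚ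
    ... | yes Fα≡0 = trans (cong (_* δ (sort α) ν) Fα≡0)
      (trans (ℚP.*-zeroˡ (δ (sort α) ν)) (sym (trans (cong (δ ν α *_) Fα≡0) (ℚP.*-zeroʳ (δ ν α)))))
    ... | no Fα≢0 = trans (cong (λ β → F α * δ β ν) (sort-Sorted α (proj₁ (proj₁ (supp α Fα≢0)))))
      (trans (ℚP.*-comm (F α) _) (cong (_* F α) (χ-cong sym sym (LP.≡-dec ℕ._≟_ α ν) (LP.≡-dec ℕ._≟_ ν α))))
    summand : (α : List ℕ) → ω F α * ωp α (coeffWeight ν) ≡ δ ν α * F α
    summand α = trans (solve 3 (λ s f d → s :* f :* (s :* d) := s :* s :* (f :* d)) refl (sgnα α) (F α) (δ (sort α) ν))
      (trans (cong (_* (F α * δ (sort α) ν)) (sgn-*-sgn (sum α ∸ length α)))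
        (trans (ℚP.*-identityˡ _) (sorted-support α)))
    picks-ν : Dec (sum ν ≡ n) → Σ[ comps n ] (λ α → δ ν α * F α) ≡ F ν
    picks-ν (yes Σν≡n) = Σ-comps-δ n ν (pos , Σν≡n) F
    picks-ν (no Σν≢n) = trans (Σ-comps-δ-≢ n ν Σν≢n F) (sym (F-vanishes ν (λ supp-ν → Σν≢n (proj₂ supp-ν))))

lemma3p3 : (n : ℕ) (F : List ℕ → ℚ)
    → (∀ μ → F μ ≢ 0ℚ → IsPartition μ × sum μ ≡ n)
    → (∀ μ → IsPartition μ → 0ℚ ≤ ω F μ)
    → ∃ λ (b : List ℕ → ℚ)
    → (∀ α → 0ℚ ≤ b α)
    × (∀ μ → IsPartition μ
    → F μ ≡ Σ[ comps n ] (λ α → b α * coeffQ1 (Cs α one) μ))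
    × (∀ μ → IsPartition μ
    → Σ[ comps n ] (λ α → b α * coeffQ1 (Cs α one) μ)
    ≡ Σ[ comps n ] (λ α → sgn (n ∸ length α) * b α * coeffQ1 (hProd α) μ))
lemma3p3 n F supp 0≤ωF with Expansion-Σ-ωp n (ω F) (ω-nonNeg supp 0≤ωF)
... | L , nn , rep = coefficientOf L , 0≤coefficientOf nn , expansion , signs
  where
  at-Cs : (μ : List ℕ) → (α : List ℕ) → IsComposition n α →
    coefficientOf L α * hTerm α (coeffWeight μ) ≡ coefficientOf L α * coeffQ1 (Cs α one) μ
  at-Cs μ α comp = cong (coefficientOf L α *_) (sym (trans (coeffQ1-⟦⟧ (Cs α one) μ) (⟦⟧-Cs (proj₁ comp) (coeffWeight μ))))
  expansion : ∀ μ → IsPartition μ → F μ ≡ Σ[ comps n ] (λ α → coefficientOf L α * coeffQ1 (Cs α one) μ)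
  expansion μ (_ , pos) = begin
    F μ                                                                  ≡⟨ Σ-ω-ωp supp μ pos ⟨
    Σ[ comps n ] (λ α → ω F α * ωp α (coeffWeight μ))                    ≡⟨ rep (coeffWeight μ) ⟩
    ⟦ L ⟧ᶜ (coeffWeight μ)                                               ≡⟨ ⟦⟧ᶜ-collect nn (coeffWeight μ) ⟩
    Σ[ comps n ] (λ α → coefficientOf L α * hTerm α (coeffWeight μ))     ≡⟨ Σ-cong-All (All.map (λ {α} → at-Cs μ α) (comps-sound n)) ⟩
    Σ[ comps n ] (λ α → coefficientOf L α * coeffQ1 (Cs α one) μ)        ∎
  signs : ∀ μ → IsPartition μ → Σ[ comps n ] (λ α → coefficientOf L α * coeffQ1 (Cs α one) μ)
    ≡ Σ[ comps n ] (λ α → sgn (n ∸ length α) * coefficientOf L α * coeffQ1 (hProd α) μ)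
  signs μ _ = Σ-cong-All (All.map (λ {α} comp → trans (cong (coefficientOf L α *_) (coeffQ1-Cs comp μ))
    (solve 3 (λ b s c → b :* (s :* c) := s :* b :* c) refl (coefficientOf L α) (sgn (n ∸ length α)) (coeffQ1 (hProd α) μ)))
    (comps-sound n))
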